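{- Let $G$ be a 2d-Rubik's shape with distinguished cycles $C_1,\dots,C_n$, in which any two distinct distinguished cycles share at most one edge, and suppose $G$ is complete and at least one of the cycles $C_1,\dots,C_n$ has an even number of edges. Let $G'$ be obtained from $G$ by one step of the inductive construction of 2d-Rubik's shapes in which the new cycle shares exactly one edge with $G$ (i.e. the path $P$ consists of a single edge). Then $G'$, with its distinguished cycles, is a complete 2d-Rubik's shape.
   Context: A 2d-Rubik's shape is a graph $G$ together with a set of distinct cycles $\{C_1,\dots,C_n\}$ of $G$, defined inductively: (1) for $m\ge 3$, an $m$-cycle (with itself as the unique distinguished cycle) is a 2d-Rubik's shape; (2) if $G$ with distinguished cycles $\{C_1,\dots,C_n\}$ is a 2d-Rubik's shape and $P$ is a path in $G$ with at least two vertices such that $E(P)\cap E(C_i)\cap E(C_j)=\emptyset$ for all distinct $i,j$, and $G'$ is obtained by adding new vertices $v_1,\dots,v_k$ with $v_i$ adjacent to $v_{i+1}$ and $v_1,v_k$ joined by edges to the two different endpoints of $P$, then $G'$ with distinguished cycles $\{C_1,\dots,C_n\}\cup\{P\cup\{v_1,\dots,v_k\}\}$ is a 2d-Rubik's shape. For each distinguished cycle $C_i$, let $\sigma_i\in\mathrm{Sym}(E(G))$ be the permutation of the edge set which rotates the edges of $C_i$ cyclically one step and fixes all other edges. The shape is complete if the subgroup of $\mathrm{Sym}(E(G))$ generated by $\sigma_1,\dots,\sigma_n$ is (isomorphic to, equivalently equal to) $\mathrm{Sym}(E(G))$. A cycle is even if it has an even number of edges. -}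

module Defs where

open import Data.Nat using (ℕ; zero; suc; _+_; _≤_)
open import Data.Nat.Divisibility using (_∣_)
open import Data.Fin using (Fin; zero; suc; _↑ˡ_; _↑ʳ_; _≟_; splitAt)
open import Data.Fin.Permutation using (Permutation′; _⟨$⟩ʳ_)
open import Data.List using (List; []; _∷_; map; length; lookup; allFin; reverse; _++_)
open import Data.List.Membership.Propositional using (_∈_)
open import Data.List.Relation.Unary.Unique.Propositional using (Unique)
open import Data.Maybe using (Maybe; just; nothing)
open import Data.Product using (_×_; _,_; proj₁; proj₂; ∃)
open import Data.Sum using (_⊎_; inj₁; inj₂)
open import Data.Bool using (Bool; true; false)
open import Data.Unit using (⊤)
open import Relation.Nullary using (yes; no; ¬_)
open import Relation.Binary.PropositionalEquality using (_≡_)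

-- Shapes: a finite graph with labelled vertices Fin nV and edges Fin nE
-- (each edge given by its two endpoints), together with the list of
-- distinguished cycles, each cycle given as the cyclic sequence of its
-- edges (consecutive edges in the list are consecutive on the cycle).

record Shape : Set where
  field
    nV     : ℕ
    nE     : ℕ
    ends   : Fin nE → Fin nV × Fin nV
    cycles : List (List (Fin nE))
open Shape public

lowerMaybe : ∀ k → Fin (suc k) → Maybe (Fin k)
lowerMaybe zero    zero    = nothing
lowerMaybe (suc k) zero    = just zero
lowerMaybe (suc k) (suc i) with lowerMaybe k i
... | just j  = just (suc j)
... | nothing = nothing

cycSuc : ∀ {n} → Fin (suc n) → Fin (suc n)
cycSuc {n} i with lowerMaybe n i
... | just j  = suc j
... | nothing = zero

cycleShape : ℕ → Shape
cycleShape zero = record { nV = 0 ; nE = 0 ; ends = λ () ; cycles = [] ∷ [] }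
cycleShape (suc n) = record
  { nV = suc n ; nE = suc n ; ends = λ i → i , cycSuc i
  ; cycles = allFin (suc n) ∷ [] }

Joins : ∀ {V} → V × V → V → V → Set
Joins (a , b) u w = (a ≡ u × b ≡ w) ⊎ (a ≡ w × b ≡ u)

-- a walk from u given as a list of steps (edge, next vertex)
IsWalk : (S : Shape) → Fin (nV S) → List (Fin (nE S) × Fin (nV S)) → Set
IsWalk S u [] = ⊤
IsWalk S u ((e , w) ∷ rest) = Joins (ends S e) u w × IsWalk S w rest

endVertex : ∀ {V E : Set} → V → List (E × V) → V
endVertex u [] = u
endVertex u ((_ , w) ∷ rest) = endVertex w rest

record Path (S : Shape) : Set where
  field
    start    : Fin (nV S)
    steps    : List (Fin (nE S) × Fin (nV S))
    nonTriv  : 1 ≤ length steps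
    walk     : IsWalk S start steps
    distinct : Unique (start ∷ map proj₂ steps)
open Path public

pathEdges : ∀ {S} → Path S → List (Fin (nE S))
pathEdges P = map proj₁ (steps P)

pathEnd : ∀ {S} → Path S → Fin (nV S)
pathEnd P = endVertex (start P) (steps P)

Admissible : (S : Shape) → Path S → Set
Admissible S P = ∀ e → e ∈ pathEdges P → (i j : Fin (length (cycles S))) →
  e ∈ lookup (cycles S) i → e ∈ lookup (cycles S) j → i ≡ j

-- One step of the construction: add suc k new vertices v_1..v_{k+1}
-- (Fin (suc k), placed after the old vertices), forming a path
-- pathEnd P – v_1 – ... – v_{k+1} – start P  with k+2 new edges.

extend : (S : Shape) → Path S → (k : ℕ) → Shape
extend S P k = record
  { nV = nV S + suc k
  ; nE = nE S + suc (suc k)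
  ; ends = ends′
  ; cycles = map (map oldE) (cycles S)
             ++ ((map oldE (pathEdges P) ++ map (nE S ↑ʳ_) (allFin (suc (suc k)))) ∷ [])
  }
  where
  oldV : Fin (nV S) → Fin (nV S + suc k)
  oldV v = v ↑ˡ suc k
  newV : Fin (suc k) → Fin (nV S + suc k)
  newV j = nV S ↑ʳ j
  oldE : Fin (nE S) → Fin (nE S + suc (suc k))
  oldE e = e ↑ˡ suc (suc k)
  fstNew : Fin (suc (suc k)) → Fin (nV S + suc k)
  fstNew zero    = oldV (pathEnd P)
  fstNew (suc j) = newV j
  sndNew : Fin (suc (suc k)) → Fin (nV S + suc k)
  sndNew j with lowerMaybe (suc k) j
  ... | just j′ = newV j′
  ... | nothing = oldV (start P)
  ends′ : Fin (nE S + suc (suc k)) → Fin (nV S + suc k) × Fin (nV S + suc k)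
  ends′ e with splitAt (nE S) e
  ... | inj₁ e′ = let (a , b) = ends S e′ in oldV a , oldV b
  ... | inj₂ j  = fstNew j , sndNew j

data IsRubik : Shape → Set where
  base : (m : ℕ) → 3 ≤ m → IsRubik (cycleShape m)
  step : ∀ {S} → IsRubik S → (P : Path S) → Admissible S P → (k : ℕ) →
         IsRubik (extend S P k)

-- rotFrom first a rest x : image of x under the rotation of the cycle
-- whose remaining part (starting at a) is a ∷ rest, with first the
-- first edge of the whole cycle
rotFrom : ∀ {n} → Fin n → Fin n → List (Fin n) → Fin n → Fin n
rotFrom first a [] x with x ≟ a
... | yes _ = first
... | no  _ = x
rotFrom first a (b ∷ rest) x with x ≟ a
... | yes _ = b
... | no  _ = rotFrom first b rest x

rot : ∀ {n} → List (Fin n) → Fin n → Fin n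
rot [] x = x
rot (a ∷ rest) x = rotFrom a a rest x

-- σ_i (true) and σ_i⁻¹ (false)
gen : (S : Shape) → Fin (length (cycles S)) → Bool → Fin (nE S) → Fin (nE S)
gen S i true  = rot (lookup (cycles S) i)
gen S i false = rot (reverse (lookup (cycles S) i))

Word : Shape → Set
Word S = List (Fin (length (cycles S)) × Bool)

evalWord : (S : Shape) → Word S → Fin (nE S) → Fin (nE S)
evalWord S [] x = x
evalWord S ((i , b) ∷ w) x = gen S i b (evalWord S w x)

Complete : Shape → Set
Complete S = ∀ (π : Permutation′ (nE S)) →
  ∃ λ (w : Word S) → ∀ x → evalWord S w x ≡ π ⟨$⟩ʳ x

ShareAtMostOneEdge : Shape → Set
ShareAtMostOneEdge S = ∀ (i j : Fin (length (cycles S))) → ¬ (i ≡ j) →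
  ∀ e e′ → e ∈ lookup (cycles S) i → e ∈ lookup (cycles S) j →
  e′ ∈ lookup (cycles S) i → e′ ∈ lookup (cycles S) j → e ≡ e′

HasEvenCycle : Shape → Set
HasEvenCycle S = ∃ λ (i : Fin (length (cycles S))) → 2 ∣ length (lookup (cycles S) i)

-- Let C be the new cycle, meeting G in the single edge e₀, and let ρ be its rotation.
-- Words in the old generators act on the old edges exactly as in G and fix the new
-- edges, so completeness of G gives every transposition of two old edges.  Fix an
-- old edge x ≠ e₀; ρ fixes x, so conjugating (x e₀) by ρ, ρ², … yields (x y) for
-- every edge y of C.  Transpositions through one point generate all transpositions,
-- and these generate the full symmetric group on E(G′).
module Submission where

open import Defs
open import Data.Nat using (ℕ; zero; suc; _≤_; s≤s)
open import Data.Nat.Properties using (≤-trans; <⇒≤; m≤m+n)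
open import Data.Fin using (Fin; zero; suc; _↑ˡ_; _↑ʳ_; _≟_; splitAt)
open import Data.Fin.Properties
  using (↑ˡ-injective; ↑ʳ-injective; splitAt-↑ˡ; splitAt-↑ʳ; splitAt⁻¹-↑ˡ; splitAt⁻¹-↑ʳ)
open import Data.Fin.Permutation using (_⟨$⟩ʳ_)
import Data.Fin.Permutation as Perm
open import Data.Fin.Permutation.Components using (transpose)
open import Data.Fin.Permutation.Transposition.List using (TranspositionList; eval; decompose; eval-decompose)
open import Data.List using (List; []; _∷_; _++_; map; length; lookup; allFin; reverse; head)
open import Data.List.Properties using (++-assoc; ++-ʳ++; ʳ++-defn; reverse-involutive; reverse-map)
open import Data.List.Membership.Propositional using (_∈_; _∉_)
open import Data.List.Membership.Propositional.Properties using (∈-++⁺ˡ; ∈-++⁺ʳ; ∈-map⁺; ∈-map⁻; ∈-lookup; ∈-allFin)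
import Data.List.Membership.DecPropositional as DecMembership
open import Data.List.Relation.Unary.Any using (here; there; index)
open import Data.List.Relation.Unary.Any.Properties using (reverse⁻; lookup-index)
open import Data.List.Relation.Unary.All as All using (All; []; _∷_)
open import Data.List.Relation.Unary.AllPairs using (_∷_)
open import Data.List.Relation.Unary.Unique.Propositional using (Unique)
import Data.List.Relation.Unary.Unique.Propositional.Properties as Unique
import Data.List.Relation.Binary.Permutation.Setoid.Properties as ↭ₛ
open import Data.List.Relation.Binary.Permutation.Setoid using (↭-sym)
open import Data.Maybe using (fromMaybe)
open import Data.Product using (Σ; ∃; _×_; _,_; proj₁; map₁)
open import Data.Sum using (_⊎_; inj₁; inj₂)
open import Data.Bool using (true; false)
open import Data.Empty using (⊥-elim)
open import Function using (_∘_)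
open import Function.Definitions using (Injective)
open import Relation.Nullary using (yes; no)
open import Relation.Binary.PropositionalEquality

private
  variable
    n : ℕ

-- The rotation of a cycle with first edge f, run over a final segment l of it;
-- rot (a ∷ l) is rotWithFirst a (a ∷ l).
rotWithFirst : Fin n → List (Fin n) → Fin n → Fin n
rotWithFirst f []         x = x
rotWithFirst f (a ∷ rest) x = rotFrom f a rest x

rotFrom-∉ : ∀ (f a : Fin n) rest x → x ∉ a ∷ rest → rotFrom f a rest x ≡ x
rotFrom-∉ f a [] x x∉ with x ≟ a
... | yes x≡a = ⊥-elim (x∉ (here x≡a))
... | no _    = refl
rotFrom-∉ f a (b ∷ rest) x x∉ with x ≟ a
... | yes x≡a = ⊥-elim (x∉ (here x≡a))
... | no _    = rotFrom-∉ f b rest x (x∉ ∘ there)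

rot-∉ : ∀ (l : List (Fin n)) x → x ∉ l → rot l x ≡ x
rot-∉ []      x _ = refl
rot-∉ (a ∷ l) x   = rotFrom-∉ a a l x

rotWithFirst-skip : ∀ (f x : Fin n) l u → u ≢ x → u ∈ l →
                    rotWithFirst f (x ∷ l) u ≡ rotWithFirst f l u
rotWithFirst-skip f x (y ∷ l) u u≢x _ with u ≟ x
... | yes u≡x = ⊥-elim (u≢x u≡x)
... | no _    = refl

rotWithFirst-at : ∀ (f : Fin n) xs u ys → Unique (xs ++ u ∷ ys) →
                  rotWithFirst f (xs ++ u ∷ ys) u ≡ fromMaybe f (head ys)
rotWithFirst-at f [] u [] _ with u ≟ u
... | yes _   = refl
... | no u≢u  = ⊥-elim (u≢u refl)
rotWithFirst-at f [] u (v ∷ ys) _ with u ≟ u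
... | yes _   = refl
... | no u≢u  = ⊥-elim (u≢u refl)
rotWithFirst-at f (x ∷ xs) u ys (x∉ ∷ unique) =
  trans (rotWithFirst-skip f x (xs ++ u ∷ ys) u (λ u≡x → All.lookup x∉ u∈ (sym u≡x)) u∈)
        (rotWithFirst-at f xs u ys unique)
  where
  u∈ : u ∈ xs ++ u ∷ ys
  u∈ = ∈-++⁺ʳ xs (here refl)

rot-inside : ∀ xs (u v : Fin n) ys → Unique (xs ++ u ∷ v ∷ ys) → rot (xs ++ u ∷ v ∷ ys) u ≡ v
rot-inside []       u v ys = rotWithFirst-at u [] u (v ∷ ys)
rot-inside (x ∷ xs) u v ys = rotWithFirst-at x (x ∷ xs) u (v ∷ ys)

rot-last : ∀ (v : Fin n) tl mid u → v ∷ tl ≡ mid ++ u ∷ [] → Unique (v ∷ tl) → rot (v ∷ tl) u ≡ v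
rot-last v tl mid u eq unique = begin
  rotWithFirst v (v ∷ tl) u         ≡⟨ cong (λ l → rotWithFirst v l u) eq ⟩
  rotWithFirst v (mid ++ u ∷ []) u  ≡⟨ rotWithFirst-at v mid u [] (subst Unique eq unique) ⟩
  v                                 ∎
  where open ≡-Reasoning

data Follows {A : Set} (l : List A) (u v : A) : Set where
  inside : ∀ xs ys → l ≡ xs ++ u ∷ v ∷ ys → Follows l u v
  around : ∀ tl mid → l ≡ v ∷ tl → l ≡ mid ++ u ∷ [] → Follows l u v

follows-∃ : ∀ {A : Set} {l : List A} {u} → u ∈ l → ∃ (Follows l u)
follows-∃ {l = a ∷ []}    (here refl) = a , around [] [] refl refl
follows-∃ {l = a ∷ b ∷ l} (here refl) = b , inside [] l refl
follows-∃ {l = a ∷ l}     (there u∈) with follows-∃ u∈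
... | v , inside xs ys eq      = v , inside (a ∷ xs) ys (cong (a ∷_) eq)
... | v , around tl mid eq eq′ = a , around l (a ∷ mid) refl (cong (a ∷_) eq′)

follows-reverse : ∀ {A : Set} {l : List A} {u v} → Follows l u v → Follows (reverse l) v u
follows-reverse (inside xs ys refl) =
  inside (reverse ys) (reverse xs) (trans (++-ʳ++ xs) (ʳ++-defn ys))
follows-reverse (around tl mid refl eq) =
  around (reverse mid) (reverse tl) (trans (cong reverse eq) (++-ʳ++ mid)) (ʳ++-defn tl)

rot-follows : ∀ {l : List (Fin n)} {u v} → Unique l → Follows l u v → rot l u ≡ v
rot-follows unique (inside xs ys refl)   = rot-inside xs _ _ ys unique
rot-follows unique (around tl mid refl eq) = rot-last _ tl mid _ eq unique

unique-reverse : ∀ {l : List (Fin n)} → Unique l → Unique (reverse l)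
unique-reverse {l = l} = ↭ₛ.Unique-resp-↭ (setoid _) (↭-sym (setoid _) (↭ₛ.↭-reverse (setoid _) l))

rot-reverse-inverseˡ : ∀ {l : List (Fin n)} → Unique l → ∀ x → rot (reverse l) (rot l x) ≡ x
rot-reverse-inverseˡ {l = l} unique x with DecMembership._∈?_ _≟_ x l
... | yes x∈ = let v , x↦v = follows-∃ x∈ in
  trans (cong (rot (reverse l)) (rot-follows unique x↦v))
        (rot-follows (unique-reverse unique) (follows-reverse x↦v))
... | no x∉ =
  trans (cong (rot (reverse l)) (rot-∉ l x x∉)) (rot-∉ (reverse l) x (x∉ ∘ reverse⁻))

rot-reverse-inverseʳ : ∀ {l : List (Fin n)} → Unique l → ∀ x → rot l (rot (reverse l) x) ≡ x
rot-reverse-inverseʳ {l = l} unique x =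
  trans (cong (λ l′ → rot l′ (rot (reverse l) x)) (sym (reverse-involutive l)))
        (rot-reverse-inverseˡ (unique-reverse unique) x)

module _ {m} {f : Fin m → Fin n} (f-injective : Injective _≡_ _≡_ f) where

  rotFrom-map : ∀ first a rest x →
                rotFrom (f first) (f a) (map f rest) (f x) ≡ f (rotFrom first a rest x)
  rotFrom-map first a [] x with x ≟ a | f x ≟ f a
  ... | yes _   | yes _     = refl
  ... | yes x≡a | no fx≢fa  = ⊥-elim (fx≢fa (cong f x≡a))
  ... | no x≢a  | yes fx≡fa = ⊥-elim (x≢a (f-injective fx≡fa))
  ... | no _    | no _      = refl
  rotFrom-map first a (b ∷ rest) x with x ≟ a | f x ≟ f a
  ... | yes _   | yes _     = refl
  ... | yes x≡a | no fx≢fa  = ⊥-elim (fx≢fa (cong f x≡a))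
  ... | no x≢a  | yes fx≡fa = ⊥-elim (x≢a (f-injective fx≡fa))
  ... | no _    | no _      = rotFrom-map first b rest x

  rot-map : ∀ l x → rot (map f l) (f x) ≡ f (rot l x)
  rot-map []      x = refl
  rot-map (a ∷ l) x = rotFrom-map a a l x

rot-orbit : ∀ {l : List (Fin n)} (Q : Fin n → Set) → Unique l → (∀ z → Q z → Q (rot l z)) →
            ∀ xs u ys → l ≡ xs ++ u ∷ ys → Q u → All Q ys
rot-orbit Q unique closed xs u []       eq Qu = []
rot-orbit Q unique closed xs u (v ∷ ys) eq Qu =
  Qv ∷ rot-orbit Q unique closed (xs ++ u ∷ []) v ys (trans eq (sym (++-assoc xs (u ∷ []) (v ∷ ys)))) Qv
  where
  Qv = subst Q (rot-follows unique (inside xs ys eq)) (closed u Qu)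

transpose-matchˡ : ∀ (i j : Fin n) → transpose i j i ≡ j
transpose-matchˡ i j with i ≟ i
... | yes _   = refl
... | no i≢i  = ⊥-elim (i≢i refl)

transpose-matchʳ : ∀ (i j : Fin n) → transpose i j j ≡ i
transpose-matchʳ i j with j ≟ i
... | yes j≡i = j≡i
... | no _ with j ≟ j
...   | yes _   = refl
...   | no j≢j  = ⊥-elim (j≢j refl)

transpose-fix : ∀ (i j k : Fin n) → k ≢ i → k ≢ j → transpose i j k ≡ k
transpose-fix i j k k≢i k≢j with k ≟ i
... | yes k≡i = ⊥-elim (k≢i k≡i)
... | no _ with k ≟ j
...   | yes k≡j = ⊥-elim (k≢j k≡j)
...   | no _    = refl

data TransposeCase (i j k : Fin n) : Set where
  at-i  : k ≡ i → TransposeCase i j k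
  at-j  : k ≢ i → k ≡ j → TransposeCase i j k
  fixed : k ≢ i → k ≢ j → TransposeCase i j k

transposeCase : ∀ (i j k : Fin n) → TransposeCase i j k
transposeCase i j k with k ≟ i
... | yes k≡i = at-i k≡i
... | no k≢i with k ≟ j
...   | yes k≡j = at-j k≢i k≡j
...   | no k≢j  = fixed k≢i k≢j

transpose-involutive : ∀ (i j k : Fin n) → transpose i j (transpose i j k) ≡ k
transpose-involutive i j k with transposeCase i j k
... | at-i refl   = trans (cong (transpose i j) (transpose-matchˡ i j)) (transpose-matchʳ i j)
... | at-j _ refl = trans (cong (transpose i j) (transpose-matchʳ i j)) (transpose-matchˡ i j)
... | fixed k≢i k≢j = trans (cong (transpose i j) (transpose-fix i j k k≢i k≢j)) (transpose-fix i j k k≢i k≢j)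

transpose-diag : ∀ (i k : Fin n) → transpose i i k ≡ k
transpose-diag i k with transposeCase i i k
... | at-i refl     = transpose-matchˡ i i
... | at-j _ refl   = transpose-matchˡ i i
... | fixed k≢i _   = transpose-fix i i k k≢i k≢i

transpose-comm : ∀ (i j k : Fin n) → transpose i j k ≡ transpose j i k
transpose-comm i j k with transposeCase i j k
... | at-i refl     = trans (transpose-matchˡ i j) (sym (transpose-matchʳ j i))
... | at-j _ refl   = trans (transpose-matchʳ i j) (sym (transpose-matchˡ j i))
... | fixed k≢i k≢j = trans (transpose-fix i j k k≢i k≢j) (sym (transpose-fix j i k k≢j k≢i))

transpose-map : ∀ {m} {f : Fin m → Fin n} → Injective _≡_ _≡_ f →
                ∀ i j k → transpose (f i) (f j) (f k) ≡ f (transpose i j k)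
transpose-map {f = f} f-injective i j k with transposeCase i j k
... | at-i refl     = trans (transpose-matchˡ (f i) (f j)) (cong f (sym (transpose-matchˡ i j)))
... | at-j _ refl   = trans (transpose-matchʳ (f i) (f j)) (cong f (sym (transpose-matchʳ i j)))
... | fixed k≢i k≢j = trans (transpose-fix (f i) (f j) (f k) (k≢i ∘ f-injective) (k≢j ∘ f-injective))
                            (cong f (sym (transpose-fix i j k k≢i k≢j)))

transpose-conjugate : ∀ (g g⁻¹ : Fin n → Fin n) → (∀ x → g (g⁻¹ x) ≡ x) → (∀ x → g⁻¹ (g x) ≡ x) →
                      ∀ i j k → g (transpose i j (g⁻¹ k)) ≡ transpose (g i) (g j) k
transpose-conjugate g g⁻¹ right left i j k with transposeCase (g i) (g j) k
... | at-i refl =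
  trans (cong (g ∘ transpose i j) (left i)) (trans (cong g (transpose-matchˡ i j)) (sym (transpose-matchˡ (g i) (g j))))
... | at-j _ refl =
  trans (cong (g ∘ transpose i j) (left j)) (trans (cong g (transpose-matchʳ i j)) (sym (transpose-matchʳ (g i) (g j))))
... | fixed k≢gi k≢gj =
  trans (cong g (transpose-fix i j (g⁻¹ k) (k≢gi ∘ moved) (k≢gj ∘ moved)))
        (trans (right k) (sym (transpose-fix (g i) (g j) k k≢gi k≢gj)))
  where
  moved : ∀ {a} → g⁻¹ k ≡ a → k ≡ g a
  moved eq = trans (sym (right k)) (cong g eq)

Realizable : (S : Shape) → (Fin (nE S) → Fin (nE S)) → Set
Realizable S f = ∃ λ (w : Word S) → ∀ x → evalWord S w x ≡ f x

module _ {S : Shape} where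

  evalWord-++ : ∀ (w w′ : Word S) x → evalWord S (w ++ w′) x ≡ evalWord S w (evalWord S w′ x)
  evalWord-++ []            w′ x = refl
  evalWord-++ ((i , b) ∷ w) w′ x = cong (gen S i b) (evalWord-++ w w′ x)

  realizable-id : Realizable S (λ x → x)
  realizable-id = [] , λ _ → refl

  realizable-gen : ∀ i b → Realizable S (gen S i b)
  realizable-gen i b = (i , b) ∷ [] , λ _ → refl

  realizable-∘ : ∀ {f g} → Realizable S f → Realizable S g → Realizable S (f ∘ g)
  realizable-∘ {f} {g} (w , w≗f) (w′ , w′≗g) =
    w ++ w′ , λ x → trans (evalWord-++ w w′ x) (trans (cong (evalWord S w) (w′≗g x)) (w≗f (g x)))

  realizable-cong : ∀ {f g} → Realizable S f → (∀ x → f x ≡ g x) → Realizable S g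
  realizable-cong (w , w≗f) f≗g = w , λ x → trans (w≗f x) (f≗g x)

  realizable-conjugate : ∀ {g g⁻¹} → Realizable S g → Realizable S g⁻¹ →
                         (∀ x → g (g⁻¹ x) ≡ x) → (∀ x → g⁻¹ (g x) ≡ x) →
                         ∀ {i j} → Realizable S (transpose i j) → Realizable S (transpose (g i) (g j))
  realizable-conjugate {g} {g⁻¹} g-real g⁻¹-real right left {i} {j} t-real =
    realizable-cong (realizable-∘ g-real (realizable-∘ t-real g⁻¹-real))
                    (transpose-conjugate g g⁻¹ right left i j)

  realizable-transpose-from-star : ∀ c → (∀ y → Realizable S (transpose c y)) →
                                  ∀ i j → Realizable S (transpose i j)
  realizable-transpose-from-star c star i j with i ≟ j | i ≟ c | j ≟ c
  ... | yes refl | _        | _        = realizable-cong realizable-id (λ k → sym (transpose-diag i k))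
  ... | no _     | yes refl | _        = star j
  ... | no _     | no _     | yes refl = realizable-cong (star i) (transpose-comm c i)
  ... | no i≢j   | no i≢c   | no j≢c   =
    -- (i j) = (c i) (c j) (c i)
    subst₂ (λ a b → Realizable S (transpose a b)) (transpose-matchˡ c i) (transpose-fix c i j j≢c (i≢j ∘ sym))
      (realizable-conjugate (star i) (star i) (transpose-involutive c i) (transpose-involutive c i) (star j))

  complete-from-transpositions : (∀ i j → Realizable S (transpose i j)) → Complete S
  complete-from-transpositions transpositions π =
    realizable-cong (realizable-eval (decompose π)) (eval-decompose π)
    where
    realizable-eval : ∀ (ts : TranspositionList (nE S)) → Realizable S (eval ts ⟨$⟩ʳ_)
    realizable-eval []             = realizable-id
    realizable-eval ((i , j) ∷ ts) = realizable-∘ (realizable-eval ts) (transpositions i j)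

module OneEdgeExtension (S : Shape) (P : Path S) (k : ℕ) {e₀ : Fin (nE S)}
                        (P-edges : pathEdges P ≡ e₀ ∷ []) where

  S′ : Shape
  S′ = extend S P k

  old : Fin (nE S) → Fin (nE S′)
  old e = e ↑ˡ suc (suc k)

  new : Fin (suc (suc k)) → Fin (nE S′)
  new j = nE S ↑ʳ j

  old-injective : Injective _≡_ _≡_ old
  old-injective = ↑ˡ-injective (suc (suc k)) _ _

  old≢new : ∀ e j → old e ≢ new j
  old≢new e j eq with trans (sym (splitAt-↑ˡ (nE S) e (suc (suc k))))
                            (trans (cong (splitAt (nE S)) eq) (splitAt-↑ʳ (nE S) (suc (suc k)) j))
  ... | ()

  old-or-new : ∀ y → (∃ λ e → y ≡ old e) ⊎ (∃ λ j → y ≡ new j)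
  old-or-new y with splitAt (nE S) y in eq
  ... | inj₁ e = inj₁ (e , sym (splitAt⁻¹-↑ˡ eq))
  ... | inj₂ j = inj₂ (j , sym (splitAt⁻¹-↑ʳ eq))

  newEdges : List (Fin (nE S′))
  newEdges = map new (allFin (suc (suc k)))

  newCycle : List (Fin (nE S′))
  newCycle = old e₀ ∷ newEdges

  unique-newCycle : Unique newCycle
  unique-newCycle =
    All.tabulate (λ y∈ eq → let j , _ , y≡ = ∈-map⁻ new y∈ in old≢new e₀ j (trans eq y≡))
    ∷ Unique.map⁺ (↑ʳ-injective (nE S) _ _) (Unique.allFin⁺ _)

  cycles-extend : cycles S′ ≡ map (map old) (cycles S) ++ newCycle ∷ []
  cycles-extend = cong (λ es → map (map old) (cycles S) ++ (map old es ++ newEdges) ∷ []) P-edges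

  oldCycle∈ : ∀ i → map old (lookup (cycles S) i) ∈ cycles S′
  oldCycle∈ i = subst (map old (lookup (cycles S) i) ∈_) (sym cycles-extend)
                      (∈-++⁺ˡ (∈-map⁺ (map old) (∈-lookup {xs = cycles S} i)))

  newCycle∈ : newCycle ∈ cycles S′
  newCycle∈ = subst (newCycle ∈_) (sym cycles-extend) (∈-++⁺ʳ (map (map old) (cycles S)) (here refl))

  liftIndex : Fin (length (cycles S)) → Fin (length (cycles S′))
  liftIndex i = index (oldCycle∈ i)

  lookup-liftIndex : ∀ i → lookup (cycles S′) (liftIndex i) ≡ map old (lookup (cycles S) i)
  lookup-liftIndex i = sym (lookup-index (oldCycle∈ i))

  newIndex : Fin (length (cycles S′))
  newIndex = index newCycle∈

  lookup-newIndex : lookup (cycles S′) newIndex ≡ newCycle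
  lookup-newIndex = sym (lookup-index newCycle∈)

  gen-liftIndex : ∀ i b → Σ (List (Fin (nE S))) λ C →
                  (∀ x → gen S i b x ≡ rot C x) × (∀ y → gen S′ (liftIndex i) b y ≡ rot (map old C) y)
  gen-liftIndex i true  = lookup (cycles S) i , (λ _ → refl) , λ y → cong (λ l → rot l y) (lookup-liftIndex i)
  gen-liftIndex i false = reverse (lookup (cycles S) i) , (λ _ → refl) , λ y →
    trans (cong (λ l → rot (reverse l) y) (lookup-liftIndex i))
          (cong (λ l → rot l y) (sym (reverse-map old (lookup (cycles S) i))))

  liftWord : Word S → Word S′
  liftWord = map (map₁ liftIndex)

  evalWord-lift-old : ∀ w x → evalWord S′ (liftWord w) (old x) ≡ old (evalWord S w x)
  evalWord-lift-old []            x = refl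
  evalWord-lift-old ((i , b) ∷ w) x with gen-liftIndex i b
  ... | C , gen≗ , gen′≗ = begin
    gen S′ (liftIndex i) b (evalWord S′ (liftWord w) (old x)) ≡⟨ cong (gen S′ (liftIndex i) b) (evalWord-lift-old w x) ⟩
    gen S′ (liftIndex i) b (old (evalWord S w x))             ≡⟨ gen′≗ _ ⟩
    rot (map old C) (old (evalWord S w x))                    ≡⟨ rot-map old-injective C _ ⟩
    old (rot C (evalWord S w x))                              ≡⟨ cong old (sym (gen≗ _)) ⟩
    old (gen S i b (evalWord S w x))                          ∎
    where open ≡-Reasoning

  evalWord-lift-new : ∀ w j → evalWord S′ (liftWord w) (new j) ≡ new j
  evalWord-lift-new []            j = refl
  evalWord-lift-new ((i , b) ∷ w) j with gen-liftIndex i b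
  ... | C , _ , gen′≗ =
    trans (cong (gen S′ (liftIndex i) b) (evalWord-lift-new w j))
          (trans (gen′≗ (new j))
                 (rot-∉ (map old C) (new j) (λ j∈ → let e , _ , eq = ∈-map⁻ old j∈ in old≢new e j (sym eq))))

  realizable-old-transpose : Complete S → ∀ a b → Realizable S′ (transpose (old a) (old b))
  realizable-old-transpose complete a b with complete (Perm.transpose a b)
  ... | w , w≗ = liftWord w , acts
    where
    acts : ∀ y → evalWord S′ (liftWord w) y ≡ transpose (old a) (old b) y
    acts y with old-or-new y
    ... | inj₁ (x , refl) = trans (evalWord-lift-old w x)
                                  (trans (cong old (w≗ x)) (sym (transpose-map old-injective a b x)))
    ... | inj₂ (j , refl) = trans (evalWord-lift-new w j)
                                  (sym (transpose-fix _ _ _ (old≢new a j ∘ sym) (old≢new b j ∘ sym)))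

  ρ ρ⁻¹ : Fin (nE S′) → Fin (nE S′)
  ρ   = rot newCycle
  ρ⁻¹ = rot (reverse newCycle)

  ρ-fix-old : ∀ {x} → x ≢ e₀ → ρ (old x) ≡ old x
  ρ-fix-old x≢e₀ = rot-∉ newCycle _ λ
    { (here eq)  → x≢e₀ (old-injective eq)
    ; (there x∈) → let j , _ , eq = ∈-map⁻ new x∈ in old≢new _ j eq }

  realizable-ρ : Realizable S′ ρ
  realizable-ρ = realizable-cong (realizable-gen newIndex true) λ y → cong (λ l → rot l y) lookup-newIndex

  realizable-ρ⁻¹ : Realizable S′ ρ⁻¹
  realizable-ρ⁻¹ = realizable-cong (realizable-gen newIndex false) λ y → cong (λ l → rot (reverse l) y) lookup-newIndex

  realizable-conjugate-ρ : ∀ {i j} → Realizable S′ (transpose i j) → Realizable S′ (transpose (ρ i) (ρ j))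
  realizable-conjugate-ρ = realizable-conjugate realizable-ρ realizable-ρ⁻¹
    (rot-reverse-inverseʳ unique-newCycle) (rot-reverse-inverseˡ unique-newCycle)

  complete-extend : Complete S → ∀ {x₀} → x₀ ≢ e₀ → Complete S′
  complete-extend complete {x₀} x₀≢e₀ =
    complete-from-transpositions (realizable-transpose-from-star (old x₀) star)
    where
    Q : Fin (nE S′) → Set
    Q y = Realizable S′ (transpose (old x₀) y)

    ρ-preserves-Q : ∀ y → Q y → Q (ρ y)
    ρ-preserves-Q y Qy =
      subst (λ a → Realizable S′ (transpose a (ρ y))) (ρ-fix-old x₀≢e₀) (realizable-conjugate-ρ Qy)

    star : ∀ y → Q y
    star y with old-or-new y
    ... | inj₁ (e , refl) = realizable-old-transpose complete x₀ e
    ... | inj₂ (j , refl) =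
      All.lookup (rot-orbit Q unique-newCycle ρ-preserves-Q [] (old e₀) newEdges refl
                            (realizable-old-transpose complete x₀ e₀))
                 (∈-map⁺ new (∈-allFin j))

rubik-has-3-edges : ∀ {S} → IsRubik S → 3 ≤ nE S
rubik-has-3-edges (base zero ())
rubik-has-3-edges (base (suc m) 3≤m) = 3≤m
rubik-has-3-edges (step {S} rubik P _ k) = ≤-trans (rubik-has-3-edges rubik) (m≤m+n (nE S) _)

another-element : 2 ≤ n → (e : Fin n) → ∃ λ x → x ≢ e
another-element (s≤s (s≤s _)) zero    = suc zero , λ ()
another-element (s≤s (s≤s _)) (suc e) = zero , λ ()

length≡1⇒singleton : ∀ {A : Set} (l : List A) → length l ≡ 1 → ∃ λ x → l ≡ x ∷ []
length≡1⇒singleton (x ∷ []) refl = x , refl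

mainTheorem2 : (S : Shape) → IsRubik S → ShareAtMostOneEdge S → Complete S →
    HasEvenCycle S → (P : Path S) → Admissible S P → length (steps P) ≡ 1 →
    (k : ℕ) → IsRubik (extend S P k) × Complete (extend S P k)
mainTheorem2 S rubik _ complete _ P admissible one-step k
  with length≡1⇒singleton (steps P) one-step
... | (e₀ , _) , steps≡ with another-element (<⇒≤ (rubik-has-3-edges rubik)) e₀
...   | x₀ , x₀≢e₀ = step rubik P admissible k ,
                     OneEdgeExtension.complete-extend S P k (cong (map proj₁) steps≡) complete x₀≢e₀
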